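{- Let $\zeta$ be a primitive $13$-th root of unity and define $\phi_1(x,y)=(x+\zeta y)(x+\zeta^{12}y)(x+\zeta^{4}y)(x+\zeta^{9}y)(x+\zeta^{3}y)(x+\zeta^{10}y)$ and $\phi_2(x,y)=(x+\zeta^{2}y)(x+\zeta^{5}y)(x+\zeta^{6}y)(x+\zeta^{7}y)(x+\zeta^{8}y)(x+\zeta^{11}y)$, which have coefficients in $\mathbb{Q}(\sqrt{13})$. Let $\mathfrak{P}_{13}$ be the prime of $\mathbb{Q}(\sqrt{13})$ above $13$. If $a,b$ are integers with $\gcd(a,b)=1$, then $\phi_1(a,b)$ and $\phi_2(a,b)$ have no common prime ideal factor other than $\mathfrak{P}_{13}$. Moreover, $\nu_{\mathfrak{P}_{13}}(\phi_i(a,b))=1$ for both $i=1,2$ if $13\mid a+b$, and $\nu_{\mathfrak{P}_{13}}(\phi_i(a,b))=0$ for both $i=1,2$ if $13\nmid a+b$.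
   Context: $\nu_{\mathfrak{P}_{13}}$ denotes the $\mathfrak{P}_{13}$-adic valuation on $\mathbb{Q}(\sqrt{13})$. -}

module Defs where

open import Level using (0ℓ)
open import Data.Nat as ℕ using (ℕ; zero; suc)
open import Data.Integer as ℤ using (ℤ; +_; -[1+_])
open import Data.Product using (_×_; _,_; Σ; ∃)
open import Data.Sum using (_⊎_)
open import Data.Bool using (if_then_else_)
open import Data.List using (List; []; _∷_; map; upTo; foldr; zipWith; _++_)
open import Relation.Nullary using (¬_)
open import Relation.Unary using (Pred; _∈_)
open import Relation.Binary.PropositionalEquality using (_≡_; refl)

-- The ring of integers O of K = ℚ(√13):  O = ℤ[ω],  ω = (1+√13)/2,
-- ω² = ω + 3.  An element  p + q·ω  is represented by the pair (p , q).

record O : Set where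
  constructor _+ω_
  field
    re : ℤ
    om : ℤ
open O public

infix 5 _+ω_

infixl 6 _⊕_
infixl 7 _⊗_

_⊕_ : O → O → O
(a +ω b) ⊕ (c +ω d) = (a ℤ.+ c) +ω (b ℤ.+ d)

_⊗_ : O → O → O
(a +ω b) ⊗ (c +ω d) =
  (a ℤ.* c ℤ.+ + 3 ℤ.* b ℤ.* d) +ω (a ℤ.* d ℤ.+ b ℤ.* c ℤ.+ b ℤ.* d)

0O 1O ωO : O
0O = + 0 +ω + 0
1O = + 1 +ω + 0
ωO = + 0 +ω + 1

ι : ℤ → O
ι n = n +ω + 0

_^O_ : O → ℕ → O
x ^O zero  = 1O
x ^O suc n = x ⊗ (x ^O n)

_∣O_ : O → O → Set
x ∣O y = Σ O λ c → y ≡ c ⊗ x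

record Ideal : Set₁ where
  field
    mem   : Pred O 0ℓ
    zero∈ : 0O ∈ mem
    +∈    : ∀ {x y} → x ∈ mem → y ∈ mem → (x ⊕ y) ∈ mem
    *∈    : ∀ r {x} → x ∈ mem → (r ⊗ x) ∈ mem
open Ideal public

record IsPrimeIdeal (P : Ideal) : Set where
  field
    proper : ¬ (1O ∈ mem P)
    prime  : ∀ x y → (x ⊗ y) ∈ mem P → x ∈ mem P ⊎ y ∈ mem P
open IsPrimeIdeal public

-- √13 = 2ω - 1   (indeed (2ω - 1)² = 13)
√13 : O
√13 = -[1+ 0 ] +ω + 2

-- The prime 𝔓₁₃ of O above 13 (13 ramifies: (13) = 𝔓₁₃², 𝔓₁₃ = (√13)).
𝔓₁₃ : Ideal
𝔓₁₃ = record
  { mem   = λ x → √13 ∣O x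
  ; zero∈ = 0O , refl
  ; +∈    = +∈'
  ; *∈    = *∈'
  }
  where
  +∈' : ∀ {x y} → √13 ∣O x → √13 ∣O y → √13 ∣O (x ⊕ y)
  +∈' {x} {y} (c , refl) (d , refl) = (c ⊕ d) , distr c d
    where
    open import Data.Integer.Solver using (module +-*-Solver)
    open +-*-Solver
    distr : ∀ c d → (c ⊗ √13) ⊕ (d ⊗ √13) ≡ (c ⊕ d) ⊗ √13
    distr (a +ω b) (e +ω f) = cong₂' (solve 4 (λ a b e f →
            ((a :* con -[1+ 0 ] :+ con (+ 3) :* b :* con (+ 2))
              :+ (e :* con -[1+ 0 ] :+ con (+ 3) :* f :* con (+ 2)))
            := ((a :+ e) :* con -[1+ 0 ] :+ con (+ 3) :* (b :+ f) :* con (+ 2))) refl a b e f)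
          (solve 4 (λ a b e f →
            ((a :* con (+ 2) :+ b :* con -[1+ 0 ] :+ b :* con (+ 2))
              :+ (e :* con (+ 2) :+ f :* con -[1+ 0 ] :+ f :* con (+ 2)))
            := ((a :+ e) :* con (+ 2) :+ (b :+ f) :* con -[1+ 0 ] :+ (b :+ f) :* con (+ 2))) refl a b e f)
      where
      cong₂' : ∀ {p p' q q' : ℤ} → p ≡ p' → q ≡ q' → (p +ω q) ≡ (p' +ω q')
      cong₂' refl refl = refl
  *∈' : ∀ r {x} → √13 ∣O x → √13 ∣O (r ⊗ x)
  *∈' r (c , refl) = (r ⊗ c) , ⊗-assoc r c √13
    where
    open import Data.Integer.Solver using (module +-*-Solver)
    open +-*-Solver
    ⊗-assoc : ∀ x y z → x ⊗ (y ⊗ z) ≡ (x ⊗ y) ⊗ z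
    ⊗-assoc (a +ω b) (c +ω d) (e +ω f) = cong₂' (solve 6 (λ a b c d e f →
        a :* (c :* e :+ con (+ 3) :* d :* f) :+ con (+ 3) :* b :* (c :* f :+ d :* e :+ d :* f)
        := (a :* c :+ con (+ 3) :* b :* d) :* e :+ con (+ 3) :* (a :* d :+ b :* c :+ b :* d) :* f)
        refl a b c d e f)
      (solve 6 (λ a b c d e f →
        a :* (c :* f :+ d :* e :+ d :* f) :+ b :* (c :* e :+ con (+ 3) :* d :* f)
          :+ b :* (c :* f :+ d :* e :+ d :* f)
        := (a :* c :+ con (+ 3) :* b :* d) :* f :+ (a :* d :+ b :* c :+ b :* d) :* e
          :+ (a :* d :+ b :* c :+ b :* d) :* f)
        refl a b c d e f)
      where
      cong₂' : ∀ {p p' q q' : ℤ} → p ≡ p' → q ≡ q' → (p +ω q) ≡ (p' +ω q')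
      cong₂' refl refl = refl

_≐_ : Ideal → Ideal → Set
P ≐ Q = ∀ x → (x ∈ mem P → x ∈ mem Q) × (x ∈ mem Q → x ∈ mem P)

-- 𝔓₁₃-adic valuation: ν_𝔓₁₃(x) = k  iff  x ∈ 𝔓₁₃^k and x ∉ 𝔓₁₃^(k+1),
-- where 𝔓₁₃^k = (√13^k).
ν𝔓₁₃_≡_ : O → ℕ → Set
ν𝔓₁₃ x ≡ k = ((√13 ^O k) ∣O x) × ¬ ((√13 ^O suc k) ∣O x)

-- The binary forms φ₁, φ₂.  A binary form of degree 6 is given by its
-- coefficient list [c₀, …, c₆], meaning Σ cᵢ x^(6-i) y^i.

evalForm : List O → ℤ → ℤ → O
evalForm cs a b = go cs 6
  where
  go : List O → ℕ → O
  go []       _ = 0O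
  go (c ∷ cs) n = (c ⊗ ι (a ℤ.^ n ℤ.* b ℤ.^ (6 ℕ.∸ n))) ⊕ go cs (n ℕ.∸ 1)

φ₁coeffs : List O
φ₁coeffs = (+ 1 +ω + 0) ∷ (-[1+ 0 ] +ω + 1) ∷ (+ 2 +ω + 0) ∷ (+ 0 +ω + 1)
         ∷ (+ 2 +ω + 0) ∷ (-[1+ 0 ] +ω + 1) ∷ (+ 1 +ω + 0) ∷ []

φ₂coeffs : List O
φ₂coeffs = (+ 1 +ω + 0) ∷ (+ 0 +ω -[1+ 0 ]) ∷ (+ 2 +ω + 0) ∷ (+ 1 +ω -[1+ 0 ])
         ∷ (+ 2 +ω + 0) ∷ (+ 0 +ω -[1+ 0 ]) ∷ (+ 1 +ω + 0) ∷ []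

φ₁ φ₂ : ℤ → ℤ → O
φ₁ = evalForm φ₁coeffs
φ₂ = evalForm φ₂coeffs

-- Certificate that the coefficient lists above are exactly the products
-- of linear forms in the paper.  ℤ[ζ] is modelled as ℤ[x]/(x¹³-1) modulo
-- multiples of 1+x+…+x¹² (normal form: subtract the coefficient of x⁰).
-- ω ↦ 1 + η with η = ζ + ζ³ + ζ⁴ + ζ⁹ + ζ¹⁰ + ζ¹² (so η = (-1+√13)/2).

Zζ : Set
Zζ = List ℤ          -- [c₀, …, c₁₂], coefficient list of Σ cₖ ζ^k

idx : List ℕ
idx = upTo 13

at : Zζ → ℕ → ℤ
at []       _       = + 0
at (c ∷ _)  zero    = c
at (_ ∷ cs) (suc k) = at cs k

Σ13 : (ℕ → ℤ) → ℤ
Σ13 f = foldr (λ i s → f i ℤ.+ s) (+ 0) idx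

_⊞_ : Zζ → Zζ → Zζ
_⊞_ = zipWith ℤ._+_

_⊠_ : Zζ → Zζ → Zζ
u ⊠ v = map (λ k → Σ13 (λ i → at u i ℤ.* at v ((k ℕ.+ 13 ℕ.∸ i) ℕ.% 13))) idx

ζ^ : ℕ → Zζ
ζ^ r = map (λ k → if (r ℕ.% 13) ℕ.≡ᵇ k then + 1 else + 0) idx

0ζ : Zζ
0ζ = map (λ _ → + 0) idx

normal : Zζ → List ℤ
normal u = map (λ k → at u k ℤ.- at u 0) idx

embed : O → Zζ
embed (p +ω q) = (p ℤ.+ q) ∷ q ∷ + 0 ∷ q ∷ q ∷ + 0 ∷ + 0 ∷ + 0 ∷ + 0 ∷ q ∷ q ∷ + 0 ∷ q ∷ []

-- multiply a form (coefficients of y^0, y^1, …) by (x + ζ^r y)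
mulLin : ℕ → List Zζ → List Zζ
mulLin r cs = zipWith _⊞_ (cs ++ (0ζ ∷ [])) (0ζ ∷ map (_⊠ ζ^ r) cs)

prodLin : List ℕ → List Zζ
prodLin = foldr mulLin (embed 1O ∷ [])

φ₁-is-product : map normal (map embed φ₁coeffs) ≡ map normal (prodLin (1 ∷ 12 ∷ 4 ∷ 9 ∷ 3 ∷ 10 ∷ []))
φ₁-is-product = refl

φ₂-is-product : map normal (map embed φ₂coeffs) ≡ map normal (prodLin (2 ∷ 5 ∷ 6 ∷ 7 ∷ 8 ∷ 11 ∷ []))
φ₂-is-product = refl

-- A prime ideal P containing φ₁(a,b) and φ₂(a,b) contains 13·a¹¹ and 13·b¹¹, since both are
-- O[a,b]-combinations of φ₁ and φ₂ (whose resultant is a unit times a power of 13).  As a and b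
-- are coprime, P contains 13 = √13², hence √13, and as O/(√13) ≅ 𝔽₁₃ is a field, P = (√13) = 𝔓₁₃.
--
-- For the valuations reduce modulo √13, where ω ≡ 7: since every ζʳ ≡ 1, φᵢ(a,b) ≡ (a+b)⁶, so
-- 𝔓₁₃ ∣ φᵢ(a,b) iff 13 ∣ a+b.  If 13 ∣ a+b, the ω-coordinate of φᵢ(a,b) is ∓3b⁶ modulo a+b, and
-- 13 ∤ b by coprimality; so 13 = √13² does not divide φᵢ(a,b).
module Submission where

open import Defs
open import Data.Integer using (ℤ; _+_; +_; ∣_∣)
open import Data.Integer.Divisibility using (_∣_)
open import Data.Nat.GCD using (gcd)
open import Data.Product using (_×_)
open import Relation.Nullary using (¬_)
open import Relation.Unary using (_∈_)
open import Relation.Binary.PropositionalEquality using (_≡_)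

open import Data.Empty using (⊥; ⊥-elim)
open import Data.Fin using (zero; suc)
open import Data.Integer using (_*_; _-_; -_; _^_)
open import Data.Integer.Coprimality using (Coprime)
open import Data.Integer.Divisibility.Signed
  using (divides; ∣ᵤ⇒∣; ∣⇒∣ᵤ; ∣-refl; m∣∣m∣; ∣m⇒∣-m; ∣m⇒∣m*n; ∣n⇒∣m*n; ∣m∣n⇒∣m+n; ∣m+n∣m⇒∣n; ∣m+n∣n⇒∣m)
  renaming (_∣_ to _∣ˢ_; _∣?_ to _∣ˢ?_)
open import Data.Integer.Properties using (abs-*; pos-*; *-identityʳ)
open import Data.Integer.Solver using (module +-*-Solver)
open import Data.List using (List; []; _∷_)
open import Data.Nat as ℕ using (ℕ; zero; suc; _∸_)
open import Data.Nat.Coprimality using (gcd≡1⇒coprime; coprime-Bézout)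
import Data.Nat.Divisibility as ℕ
open import Data.Nat.GCD using (module Bézout)
open import Data.Nat.Primality using (Prime; prime?; euclidsLemma; prime⇒irreducible; ¬prime[1])
open import Data.Product using (Σ; _,_; proj₁; proj₂)
open import Data.Sum using (_⊎_; inj₁; inj₂; [_,_]′)
import Data.Sum as Sum
open import Data.Vec using (Vec; []; _∷_)
open import Function using (id)
open import Relation.Nullary using (contradiction)
open import Relation.Nullary.Decidable using (yes; no; from-yes; from-no)
open import Relation.Binary.PropositionalEquality using (refl; sym; trans; cong; cong₂; subst; module ≡-Reasoning)

open +-*-Solver using (Polynomial; con; var; _:+_; _:*_; _:-_; :-_; _:^_; ⟦_⟧; solve; _:=_)

-- The operations copy those of O clause by clause, so ⟦ x ⊗ᵖ y ⟧ᴼ ρ unfolds to ⟦ x ⟧ᴼ ρ ⊗ ⟦ y ⟧ᴼ ρ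
-- and ⟦ evalFormᵖ cs ⟧ᴼ₂ a b to evalForm cs a b: the ring solver, applied to each coordinate,
-- then proves identities about φ₁ and φ₂ up to conversion.
record Oᵖ (n : ℕ) : Set where
  constructor _+ωᵖ_
  field
    reᵖ omᵖ : Polynomial n
open Oᵖ

infix  5 _+ωᵖ_
infixl 6 _⊕ᵖ_
infixl 7 _⊗ᵖ_

⟦_⟧ᴼ : ∀ {n} → Oᵖ n → Vec ℤ n → O
⟦ p +ωᵖ q ⟧ᴼ ρ = ⟦ p ⟧ ρ +ω ⟦ q ⟧ ρ

_⊕ᵖ_ _⊗ᵖ_ : ∀ {n} → Oᵖ n → Oᵖ n → Oᵖ n
(a +ωᵖ b) ⊕ᵖ (c +ωᵖ d) = (a :+ c) +ωᵖ (b :+ d)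
(a +ωᵖ b) ⊗ᵖ (c +ωᵖ d) = (a :* c :+ con (+ 3) :* b :* d) +ωᵖ (a :* d :+ b :* c :+ b :* d)

ιᵖ : ∀ {n} → Polynomial n → Oᵖ n
ιᵖ p = p +ωᵖ con (+ 0)

constᵖ : ∀ {n} → O → Oᵖ n
constᵖ x = con (re x) +ωᵖ con (om x)

residueᵖ : ∀ {n} → Oᵖ n → Polynomial n
residueᵖ x = reᵖ x :+ con (+ 7) :* omᵖ x

Binary : Set → Set
Binary A = Polynomial 2 → Polynomial 2 → A

evalFormᵖ : List O → Binary (Oᵖ 2)
evalFormᵖ cs a b = go cs 6
  where
  go : List O → ℕ → Oᵖ 2
  go []       _ = constᵖ 0O
  go (c ∷ cs) n = constᵖ c ⊗ᵖ ιᵖ (a :^ n :* b :^ (6 ∸ n)) ⊕ᵖ go cs (n ∸ 1)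

⟦_⟧₂ : Binary (Polynomial 2) → ℤ → ℤ → ℤ
⟦ p ⟧₂ a b = ⟦ p (var zero) (var (suc zero)) ⟧ (a ∷ b ∷ [])

⟦_⟧ᴼ₂ : Binary (Oᵖ 2) → ℤ → ℤ → O
⟦ x ⟧ᴼ₂ a b = ⟦ x (var zero) (var (suc zero)) ⟧ᴼ (a ∷ b ∷ [])

13-prime : Prime 13
13-prime = from-yes (prime? 13)

euclidsLemmaᶻ : ∀ {p} x y → Prime ∣ p ∣ → p ∣ˢ x * y → p ∣ˢ x ⊎ p ∣ˢ y
euclidsLemmaᶻ {p} x y p-prime p∣xy =
  Sum.map ∣ᵤ⇒∣ ∣ᵤ⇒∣ (euclidsLemma ∣ x ∣ ∣ y ∣ p-prime (subst (∣ p ∣ ℕ.∣_) (abs-* x y) (∣⇒∣ᵤ p∣xy)))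

prime∣m^n⇒∣m : ∀ {p} x n → Prime ∣ p ∣ → p ∣ˢ x ^ n → p ∣ˢ x
prime∣m^n⇒∣m x zero    p-prime p∣1   = contradiction (subst Prime (ℕ.∣1⇒≡1 (∣⇒∣ᵤ p∣1)) p-prime) ¬prime[1]
prime∣m^n⇒∣m x (suc n) p-prime p∣xxⁿ =
  [ id , prime∣m^n⇒∣m x n p-prime ]′ (euclidsLemmaᶻ x (x ^ n) p-prime p∣xxⁿ)

prime∤⇒coprime : ∀ {p n} → Prime ∣ p ∣ → ¬ p ∣ˢ n → Coprime p n
prime∤⇒coprime p-prime p∤n (d∣p , d∣n) with prime⇒irreducible p-prime d∣p
... | inj₁ d≡1  = d≡1
... | inj₂ refl = contradiction (∣ᵤ⇒∣ d∣n) p∤n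

⊗-ι : ∀ x t → x ⊗ ι t ≡ (re x * t) +ω (om x * t)
⊗-ι x t = cong₂ _+ω_
  (solve 3 (λ p q t → reᵖ ((p +ωᵖ q) ⊗ᵖ ιᵖ t) := p :* t) refl (re x) (om x) t)
  (solve 3 (λ p q t → omᵖ ((p +ωᵖ q) ⊗ᵖ ιᵖ t) := q :* t) refl (re x) (om x) t)

ι-* : ∀ x y → ι x ⊗ ι y ≡ ι (x * y)
ι-* x = ⊗-ι (ι x)

⊗-identityʳ : ∀ x → x ⊗ 1O ≡ x
⊗-identityʳ x = trans (⊗-ι x (+ 1)) (cong₂ _+ω_ (*-identityʳ (re x)) (*-identityʳ (om x)))

ι∣O⇒∣om : ∀ {n x} → ι n ∣O x → n ∣ˢ om x
ι∣O⇒∣om {n} (c , refl) = divides (om c) (cong om (⊗-ι c n))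

-- Reduction modulo √13: as ω ≡ 7 (mod √13), x ↦ residue x mod 13 is the isomorphism O/(√13) ≅ ℤ/13.
residue : O → ℤ
residue x = re x + + 7 * om x

ι-residue : ∀ x → ι (residue x) ≡ x ⊕ ((- om x) +ω om x) ⊗ √13
ι-residue x = cong₂ _+ω_
  (solve 2 (λ p q → residueᵖ (p +ωᵖ q) := reᵖ ((p +ωᵖ q) ⊕ᵖ (:- q +ωᵖ q) ⊗ᵖ constᵖ √13)) refl (re x) (om x))
  (solve 2 (λ p q → con (+ 0) := omᵖ ((p +ωᵖ q) ⊕ᵖ (:- q +ωᵖ q) ⊗ᵖ constᵖ √13)) refl (re x) (om x))

√13∣O⇒13∣residue : ∀ {x} → √13 ∣O x → + 13 ∣ˢ residue x
√13∣O⇒13∣residue (c , refl) = divides (re c + om c)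
  (solve 2 (λ p q → residueᵖ ((p +ωᵖ q) ⊗ᵖ constᵖ √13) := (p :+ q) :* con (+ 13)) refl (re c) (om c))

13∣residue⇒√13∣O : ∀ {x} → + 13 ∣ˢ residue x → √13 ∣O x
13∣residue⇒√13∣O {p +ω q} (divides k residue≡k13) = ⟦ quotient ⟧ᴼ₂ q k , cong₂ _+ω_ re-≡ om-≡
  where
  quotient : Binary (Oᵖ 2)
  quotient q k = (q :- k) +ωᵖ (con (+ 2) :* k :- q)
  re-≡ : p ≡ re (⟦ quotient ⟧ᴼ₂ q k ⊗ √13)
  re-≡ = begin
    p                                ≡⟨ solve 2 (λ p q → p := residueᵖ (p +ωᵖ q) :- con (+ 7) :* q) refl p q ⟩
    residue (p +ω q) - + 7 * q       ≡⟨ cong (_- + 7 * q) residue≡k13 ⟩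
    k * + 13 - + 7 * q               ≡⟨ solve 2 (λ q k → k :* con (+ 13) :- con (+ 7) :* q
                                                       := reᵖ (quotient q k ⊗ᵖ constᵖ √13)) refl q k ⟩
    re (⟦ quotient ⟧ᴼ₂ q k ⊗ √13)    ∎
    where open ≡-Reasoning
  om-≡ : q ≡ om (⟦ quotient ⟧ᴼ₂ q k ⊗ √13)
  om-≡ = solve 2 (λ q k → q := omᵖ (quotient q k ⊗ᵖ constᵖ √13)) refl q k

module _ {P : Ideal} (P-prime : IsPrimeIdeal P) where

  ι-∣-∈ : ∀ {x y} → x ∣ˢ y → ι x ∈ mem P → ι y ∈ mem P
  ι-∣-∈ {x} (divides q refl) x∈P = subst (_∈ mem P) (ι-* q x) (*∈ P (ι q) x∈P)

  ι-+-∈⇒ : ∀ {x y} → ι (x + y) ∈ mem P → ι y ∈ mem P → ι x ∈ mem P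
  ι-+-∈⇒ {x} {y} x+y∈P y∈P = subst (λ z → ι z ∈ mem P)
    (solve 2 (λ x y → x :+ y :+ :- y := x) refl x y) (+∈ P x+y∈P (ι-∣-∈ (∣m⇒∣-m ∣-refl) y∈P))

  ι-*-∈ : ∀ x y → ι (x * y) ∈ mem P → ι x ∈ mem P ⊎ ι y ∈ mem P
  ι-*-∈ x y xy∈P = prime P-prime (ι x) (ι y) (subst (_∈ mem P) (sym (ι-* x y)) xy∈P)

  ι-^-∈ : ∀ x n → ι (x ^ n) ∈ mem P → ι x ∈ mem P
  ι-^-∈ x zero    1∈P   = ⊥-elim (proper P-prime 1∈P)
  ι-^-∈ x (suc n) xxⁿ∈P = [ id , ι-^-∈ x n ]′ (ι-*-∈ x (x ^ n) xxⁿ∈P)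

  ι-multiple-∈ : ∀ {x} k → ι x ∈ mem P → ι (+ (k ℕ.* ∣ x ∣)) ∈ mem P
  ι-multiple-∈ {x} k = ι-∣-∈ (subst (x ∣ˢ_) (sym (pos-* k ∣ x ∣)) (∣n⇒∣m*n (+ k) m∣∣m∣))

  ι-coprime-∉ : ∀ {x y} → Coprime x y → ι x ∈ mem P → ι y ∈ mem P → ⊥
  ι-coprime-∉ coprime x∈P y∈P with coprime-Bézout coprime
  ... | Bézout.+- u v 1+v∣y∣≡u∣x∣ = proper P-prime
    (ι-+-∈⇒ (subst (λ n → ι (+ n) ∈ mem P) (sym 1+v∣y∣≡u∣x∣) (ι-multiple-∈ u x∈P)) (ι-multiple-∈ v y∈P))
  ... | Bézout.-+ u v 1+u∣x∣≡v∣y∣ = proper P-prime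
    (ι-+-∈⇒ (subst (λ n → ι (+ n) ∈ mem P) (sym 1+u∣x∣≡v∣y∣) (ι-multiple-∈ v y∈P)) (ι-multiple-∈ u x∈P))

  ι-∈-from-coprime-powers : ∀ m a b k n → Coprime a b →
    ι (m * a ^ k) ∈ mem P → ι (m * b ^ n) ∈ mem P → ι m ∈ mem P
  ι-∈-from-coprime-powers m a b k n coprime maᵏ∈P mbⁿ∈P
    with ι-*-∈ m (a ^ k) maᵏ∈P | ι-*-∈ m (b ^ n) mbⁿ∈P
  ... | inj₁ m∈P  | _         = m∈P
  ... | inj₂ _    | inj₁ m∈P  = m∈P
  ... | inj₂ aᵏ∈P | inj₂ bⁿ∈P = ⊥-elim (ι-coprime-∉ coprime (ι-^-∈ a k aᵏ∈P) (ι-^-∈ b n bⁿ∈P))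

  √13-∈ : ι (+ 13) ∈ mem P → √13 ∈ mem P
  √13-∈ 13∈P = [ id , id ]′ (prime P-prime √13 √13 13∈P)

  √13-∈⇒⊆𝔓₁₃ : √13 ∈ mem P → ∀ {x} → x ∈ mem P → x ∈ mem 𝔓₁₃
  √13-∈⇒⊆𝔓₁₃ √13∈P {x} x∈P with + 13 ∣ˢ? residue x
  ... | yes 13∣residue = 13∣residue⇒√13∣O 13∣residue
  ... | no  13∤residue = ⊥-elim (ι-coprime-∉ (prime∤⇒coprime 13-prime 13∤residue) 13∈P residue∈P)
    where
    13∈P : ι (+ 13) ∈ mem P
    13∈P = *∈ P √13 √13∈P
    residue∈P : ι (residue x) ∈ mem P
    residue∈P = subst (_∈ mem P) (sym (ι-residue x)) (+∈ P x∈P (*∈ P ((- om x) +ω om x) √13∈P))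

ν≡0 : ∀ {x} → ¬ + 13 ∣ˢ residue x → ν𝔓₁₃ x ≡ 0
ν≡0 {x} 13∤residue = (x , sym (⊗-identityʳ x)) , λ √13∣x → 13∤residue (√13∣O⇒13∣residue √13∣x)

ν≡1 : ∀ {x} → + 13 ∣ˢ residue x → ¬ + 13 ∣ˢ om x → ν𝔓₁₃ x ≡ 1
ν≡1 13∣residue 13∤om = 13∣residue⇒√13∣O 13∣residue , λ 13∣x → 13∤om (ι∣O⇒∣om 13∣x)

ν-dichotomy : ∀ a b → Coprime a b → ∀ x k → ¬ + 13 ∣ˢ k →
  (Σ ℤ λ r → residue x ≡ (a + b) ^ 6 + r * + 13) → (Σ ℤ λ s → om x ≡ (a + b) * s + k * b ^ 6) →
  (+ 13 ∣ a + b → ν𝔓₁₃ x ≡ 1) × (¬ (+ 13 ∣ a + b) → ν𝔓₁₃ x ≡ 0)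
ν-dichotomy a b coprime x k 13∤k (r , residue≡) (s , om≡) =
  (λ 13∣a+b → ν≡1 (13∣residue (∣ᵤ⇒∣ 13∣a+b)) (13∤om (∣ᵤ⇒∣ 13∣a+b))) ,
  (λ 13∤a+b → ν≡0 (λ 13∣residue → 13∤a+b (∣⇒∣ᵤ (13∣a+b 13∣residue))))
  where
  13∣r13 : + 13 ∣ˢ r * + 13
  13∣r13 = ∣n⇒∣m*n r ∣-refl
  13∣residue : + 13 ∣ˢ a + b → + 13 ∣ˢ residue x
  13∣residue 13∣a+b = subst (+ 13 ∣ˢ_) (sym residue≡) (∣m∣n⇒∣m+n (∣m⇒∣m*n ((a + b) ^ 5) 13∣a+b) 13∣r13)
  13∣a+b : + 13 ∣ˢ residue x → + 13 ∣ˢ a + b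
  13∣a+b 13∣residue =
    prime∣m^n⇒∣m (a + b) 6 13-prime (∣m+n∣n⇒∣m (subst (+ 13 ∣ˢ_) residue≡ 13∣residue) 13∣r13)
  13∤b : + 13 ∣ˢ a + b → ¬ + 13 ∣ˢ b
  13∤b 13∣a+b 13∣b = contradiction (coprime (∣⇒∣ᵤ (∣m+n∣n⇒∣m {m = a} 13∣a+b 13∣b) , ∣⇒∣ᵤ 13∣b)) λ ()
  13∤om : + 13 ∣ˢ a + b → ¬ + 13 ∣ˢ om x
  13∤om 13∣a+b 13∣om =
    [ 13∤k , (λ 13∣b⁶ → 13∤b 13∣a+b (prime∣m^n⇒∣m b 6 13-prime 13∣b⁶)) ]′
      (euclidsLemmaᶻ k (b ^ 6) 13-prime (∣m+n∣m⇒∣n (subst (+ 13 ∣ˢ_) om≡ 13∣om) (∣m⇒∣m*n s 13∣a+b)))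

φ₁ᵖ φ₂ᵖ : Binary (Oᵖ 2)
φ₁ᵖ = evalFormᵖ φ₁coeffs
φ₂ᵖ = evalFormᵖ φ₂coeffs

residue-φ₁ : ∀ a b → Σ ℤ λ r → residue (φ₁ a b) ≡ (a + b) ^ 6 + r * + 13
residue-φ₁ a b = ⟦ R ⟧₂ a b , solve 2 (λ a b → residueᵖ (φ₁ᵖ a b) := (a :+ b) :^ 6 :+ R a b :* con (+ 13)) refl a b
  where
  R : Binary (Polynomial 2)
  R a b = :- (a :^ 4 :* b :^ 2 :+ a :^ 3 :* b :^ 3 :+ a :^ 2 :* b :^ 4)

residue-φ₂ : ∀ a b → Σ ℤ λ r → residue (φ₂ a b) ≡ (a + b) ^ 6 + r * + 13
residue-φ₂ a b = ⟦ R ⟧₂ a b , solve 2 (λ a b → residueᵖ (φ₂ᵖ a b) := (a :+ b) :^ 6 :+ R a b :* con (+ 13)) refl a b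
  where
  R : Binary (Polynomial 2)
  R a b = :- (a :^ 5 :* b :+ a :^ 4 :* b :^ 2 :+ con (+ 2) :* a :^ 3 :* b :^ 3 :+ a :^ 2 :* b :^ 4 :+ a :* b :^ 5)

S : Binary (Polynomial 2)
S a b = a :^ 4 :* b :- a :^ 3 :* b :^ 2 :+ con (+ 2) :* a :^ 2 :* b :^ 3 :- con (+ 2) :* a :* b :^ 4 :+ con (+ 3) :* b :^ 5

om-φ₁ : ∀ a b → Σ ℤ λ s → om (φ₁ a b) ≡ (a + b) * s + - + 3 * b ^ 6
om-φ₁ a b = ⟦ S ⟧₂ a b , solve 2 (λ a b → omᵖ (φ₁ᵖ a b) := (a :+ b) :* S a b :+ con (- + 3) :* b :^ 6) refl a b

om-φ₂ : ∀ a b → Σ ℤ λ s → om (φ₂ a b) ≡ (a + b) * s + + 3 * b ^ 6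
om-φ₂ a b = - ⟦ S ⟧₂ a b , solve 2 (λ a b → omᵖ (φ₂ᵖ a b) := (a :+ b) :* :- S a b :+ con (+ 3) :* b :^ 6) refl a b

-- A certificate U φ₁ + V φ₂ = 13 b¹¹, found by linear algebra; as φ₁ and φ₂ are symmetric in a
-- and b, exchanging a and b in U and V gives 13 a¹¹.
U V : Binary (Oᵖ 2)
U a b = (a :^ 5 :+ con (+ 7) :* a :^ 4 :* b :+ con (+ 8) :* a :^ 3 :* b :^ 2 :+ con (+ 8) :* a :^ 2 :* b :^ 3
          :+ con (+ 3) :* a :* b :^ 4 :+ con (+ 6) :* b :^ 5)
  +ωᵖ (:- (con (+ 2) :* a :^ 5 :+ a :^ 4 :* b :+ con (+ 3) :* a :^ 3 :* b :^ 2 :+ con (+ 3) :* a :^ 2 :* b :^ 3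
          :+ con (+ 6) :* a :* b :^ 4) :+ b :^ 5)
V a b = (:- a :^ 5 :+ con (+ 6) :* a :^ 4 :* b :+ con (+ 5) :* a :^ 3 :* b :^ 2 :+ con (+ 5) :* a :^ 2 :* b :^ 3
          :- con (+ 3) :* a :* b :^ 4 :+ con (+ 7) :* b :^ 5)
  +ωᵖ (con (+ 2) :* a :^ 5 :+ a :^ 4 :* b :+ con (+ 3) :* a :^ 3 :* b :^ 2 :+ con (+ 3) :* a :^ 2 :* b :^ 3
          :+ con (+ 6) :* a :* b :^ 4 :- b :^ 5)

13b¹¹-combination : ∀ a b → Σ O λ u → Σ O λ v → u ⊗ φ₁ a b ⊕ v ⊗ φ₂ a b ≡ ι (+ 13 * b ^ 11)
13b¹¹-combination a b = ⟦ U ⟧ᴼ₂ a b , ⟦ V ⟧ᴼ₂ a b , cong₂ _+ω_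
  (solve 2 (λ a b → reᵖ (U a b ⊗ᵖ φ₁ᵖ a b ⊕ᵖ V a b ⊗ᵖ φ₂ᵖ a b) := con (+ 13) :* b :^ 11) refl a b)
  (solve 2 (λ a b → omᵖ (U a b ⊗ᵖ φ₁ᵖ a b ⊕ᵖ V a b ⊗ᵖ φ₂ᵖ a b) := con (+ 0)) refl a b)

13a¹¹-combination : ∀ a b → Σ O λ u → Σ O λ v → u ⊗ φ₁ a b ⊕ v ⊗ φ₂ a b ≡ ι (+ 13 * a ^ 11)
13a¹¹-combination a b = ⟦ U ⟧ᴼ₂ b a , ⟦ V ⟧ᴼ₂ b a , cong₂ _+ω_
  (solve 2 (λ a b → reᵖ (U b a ⊗ᵖ φ₁ᵖ a b ⊕ᵖ V b a ⊗ᵖ φ₂ᵖ a b) := con (+ 13) :* a :^ 11) refl a b)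
  (solve 2 (λ a b → omᵖ (U b a ⊗ᵖ φ₁ᵖ a b ⊕ᵖ V b a ⊗ᵖ φ₂ᵖ a b) := con (+ 0)) refl a b)

common-prime-factor≐𝔓₁₃ : ∀ a b → Coprime a b →
  (P : Ideal) → IsPrimeIdeal P → φ₁ a b ∈ mem P → φ₂ a b ∈ mem P → P ≐ 𝔓₁₃
common-prime-factor≐𝔓₁₃ a b coprime P P-prime φ₁∈P φ₂∈P x =
  √13-∈⇒⊆𝔓₁₃ P-prime √13∈P , λ { (c , refl) → *∈ P c √13∈P }
  where
  combination-∈ : ∀ {m} → (Σ O λ u → Σ O λ v → u ⊗ φ₁ a b ⊕ v ⊗ φ₂ a b ≡ ι m) → ι m ∈ mem P
  combination-∈ (u , v , eq) = subst (_∈ mem P) eq (+∈ P (*∈ P u φ₁∈P) (*∈ P v φ₂∈P))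
  √13∈P : √13 ∈ mem P
  √13∈P = √13-∈ P-prime (ι-∈-from-coprime-powers P-prime (+ 13) a b 11 11 coprime
    (combination-∈ (13a¹¹-combination a b)) (combination-∈ (13b¹¹-combination a b)))

corollary2 : (a b : ℤ) → gcd ∣ a ∣ ∣ b ∣ ≡ 1 →
    ((P : Ideal) → IsPrimeIdeal P → φ₁ a b ∈ mem P → φ₂ a b ∈ mem P → P ≐ 𝔓₁₃)
    × ((+ 13 ∣ a + b → (ν𝔓₁₃ φ₁ a b ≡ 1) × (ν𝔓₁₃ φ₂ a b ≡ 1))
    × (¬ (+ 13 ∣ a + b) → (ν𝔓₁₃ φ₁ a b ≡ 0) × (ν𝔓₁₃ φ₂ a b ≡ 0)))
corollary2 a b gcd≡1 =
  common-prime-factor≐𝔓₁₃ a b coprime ,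
  (λ 13∣a+b → proj₁ ν₁ 13∣a+b , proj₁ ν₂ 13∣a+b) ,
  (λ 13∤a+b → proj₂ ν₁ 13∤a+b , proj₂ ν₂ 13∤a+b)
  where
  coprime : Coprime a b
  coprime = gcd≡1⇒coprime gcd≡1
  ν₁ : (+ 13 ∣ a + b → ν𝔓₁₃ φ₁ a b ≡ 1) × (¬ (+ 13 ∣ a + b) → ν𝔓₁₃ φ₁ a b ≡ 0)
  ν₁ = ν-dichotomy a b coprime (φ₁ a b) (- + 3) (from-no (+ 13 ∣ˢ? - + 3)) (residue-φ₁ a b) (om-φ₁ a b)
  ν₂ : (+ 13 ∣ a + b → ν𝔓₁₃ φ₂ a b ≡ 1) × (¬ (+ 13 ∣ a + b) → ν𝔓₁₃ φ₂ a b ≡ 0)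
  ν₂ = ν-dichotomy a b coprime (φ₂ a b) (+ 3) (from-no (+ 13 ∣ˢ? + 3)) (residue-φ₂ a b) (om-φ₂ a b)
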